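{- Let $G$ be an $n$-vertex $k$-uniform hypergraph with $\Delta(G)\le\Delta$, and let $S$ be a nonempty subset of $E(G)$. Then for positive integers $t$ and $c$, the number of subgraphs of $G$ with exactly $t$ edges, all of which lie in $S$, with no isolated vertices and with exactly $c$ components is at most $2^{(k+1)t}\Delta^t\binom{k|S|}{c}$. -}

module Defs where

open import Data.Nat using (ℕ; _≤_)
open import Data.Fin using (Fin)
open import Data.Fin.Subset using (Subset; _∈_; ∣_∣)
open import Data.Fin.Subset.Properties using (_∈?_)
open import Data.Vec using (tabulate)
open import Data.Bool using (Bool)
open import Data.List using (List; length)
open import Data.List.Relation.Unary.All using (All)
open import Data.List.Relation.Unary.Unique.Propositional using (Unique)
open import Data.Product using (Σ; ∃; _×_; _,_)
open import Relation.Nullary using (¬_)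
open import Relation.Nullary.Decidable using (does)
open import Relation.Binary.PropositionalEquality using (_≡_)
open import Relation.Binary.Construct.Closure.ReflexiveTransitive using (Star)
open import Function.Definitions using (Injective)

record Hypergraph (n : ℕ) : Set where
  field
    m        : ℕ
    edge     : Fin m → Subset n
    edge-inj : Injective _≡_ _≡_ edge
open Hypergraph public

Uniform : ∀ {n} → ℕ → Hypergraph n → Set
Uniform k G = ∀ i → ∣ edge G i ∣ ≡ k

degree : ∀ {n} (G : Hypergraph n) → Fin n → ℕ
degree G v = ∣ tabulate (λ i → does (v ∈? edge G i)) ∣

MaxDegreeAtMost : ∀ {n} → Hypergraph n → ℕ → Set
MaxDegreeAtMost G Δ = ∀ v → degree G v ≤ Δ

-- Edge sets of (sub)graphs are subsets F of the edge indices Fin m.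
-- The subgraph with edge set F and no isolated vertices has vertex set V(F),
-- the union of the edges in F.
InV : ∀ {n} (G : Hypergraph n) → Subset (m G) → Fin n → Set
InV G F v = ∃ λ i → i ∈ F × v ∈ edge G i

Adj : ∀ {n} (G : Hypergraph n) → Subset (m G) → Fin n → Fin n → Set
Adj G F u v = ∃ λ i → i ∈ F × u ∈ edge G i × v ∈ edge G i

Conn : ∀ {n} (G : Hypergraph n) → Subset (m G) → Fin n → Fin n → Set
Conn G F = Star (Adj G F)

-- The subgraph (V(F), F) has exactly c connected components:
-- there are c vertices of V(F), pairwise in distinct components,
-- such that every vertex of V(F) is in the component of one of them.
HasComponents : ∀ {n} (G : Hypergraph n) → Subset (m G) → ℕ → Set
HasComponents {n} G F c =
  Σ (Fin c → Fin n) λ r →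
    (∀ j → InV G F (r j)) ×
    (∀ i j → Conn G F (r i) (r j) → i ≡ j) ×
    (∀ v → InV G F v → ∃ λ j → Conn G F v (r j))

-- "the number of x with P x is at most B": every duplicate-free list of
-- elements satisfying P has length at most B.
NumberAtMost : ∀ {A : Set} → (A → Set) → ℕ → Set
NumberAtMost {A} P B = (xs : List A) → Unique xs → All P xs → length xs ≤ B

Counted : ∀ {n} (G : Hypergraph n) → Subset (m G) → ℕ → ℕ → Subset (m G) → Set
Counted G S t c F = F Data.Fin.Subset.⊆ S × ∣ F ∣ ≡ t × HasComponents G F c

-- Encoding argument. Fix a root in each component of F and explore F from the roots:
-- repeatedly take a vertex that is discovered (a root or a vertex of a chosen edge) but
-- not yet explored, and either choose a further edge of F at it, recorded by a 1 and the
-- position of that edge among the at most Δ edges at the vertex, or mark the vertex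
-- explored, recorded by a 0. Every step enlarges the explored vertices (at most kt of them)
-- or the chosen edges (at most t), so (k+1)t bits and t labels suffice; and once nothing is
-- left to explore, all of F is chosen, because every edge of F is joined to a root by a
-- walk in F. The roots form a c-subset of V(S), and |V(S)| ≤ k|S|, so F is the decoding of
-- one of at most C(k|S|, c) · 2^((k+1)t) · Δ^t codes.

module Submission where

open import Defs
open import Data.Nat using (ℕ; zero; suc; _+_; _*_; _^_; _≤_; _<_; _≤′_; ≤′-refl; ≤′-step; z≤n; s≤s; NonZero)
open import Data.Nat.Properties
  using (≤-refl; ≤-reflexive; ≤-trans; ≤⇒≤′; ≤⇒≯; <⇒≢; m≤m+n; m≤n+m; +-suc; +-identityʳ; *-identityˡ; *-comm; *-distribʳ-+; +-mono-≤; +-monoˡ-≤; +-monoʳ-≤; *-monoˡ-≤; +-cancelˡ-≤; suc-injective; module ≤-Reasoning)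
open import Data.Nat.Combinatorics using (_C_; nCk+nC[k+1]≡[n+1]C[k+1])
open import Data.Bool using (Bool; true; false)
open import Data.Fin using (Fin; zero; suc; toℕ; inject≤)
import Data.Fin.Properties as Fin
open import Data.Fin.Properties using (injective⇒≤; any?; toℕ-inject≤)
open import Data.Fin.Subset using (Subset; Nonempty; ∣_∣; _∈_; _∉_; _⊆_; _∪_; ⁅_⁆; ⋃; ⊥; inside; outside)
open import Data.Fin.Subset.Properties
  using ( _∈?_; ∉⊥; x∈⁅x⁆; x∈⁅y⁆⇒x≡y; ∣⁅x⁆∣≡1; ∣⊥∣≡0; ∣p∣≤∣x∷p∣; x∈p∪q⁺; x∈p∪q⁻; p⊆p∪q; ∪-identityʳ
        ; drop-∷-⊆; ⊆-antisym; p⊆q⇒∣p∣≤∣q∣; p⊂q⇒∣p∣<∣q∣; nonempty?; Empty-unique)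
open import Data.Vec using ([]; _∷_; here; there; tabulate)
open import Data.Vec.Properties using (lookup⇒[]=; lookup∘tabulate)
open import Data.Maybe using (Maybe; just; maybe′)
open import Data.List using (List; []; _∷_; _++_; map; length; lookup; head; drop; replicate; allFin; cartesianProductWith; cartesianProduct)
open import Data.List.Properties using (length-map; length-++; length-replicate; length-tabulate)
open import Data.List.Relation.Unary.Any as Any using (here; there)
import Data.List.Relation.Unary.All as All
open import Data.List.Relation.Unary.AllPairs using (_∷_)
open import Data.List.Relation.Unary.Unique.Propositional using (Unique)
open import Data.List.Membership.Propositional using () renaming (_∈_ to _∈ₗ_)
open import Data.List.Membership.Propositional.Properties
  using (∈-map⁺; ∈-++⁺ˡ; ∈-++⁺ʳ; ∈-lookup; ∈-allFin; ∈-cartesianProductWith⁺; ∈-cartesianProduct⁺)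
open import Data.List.Membership.Setoid.Properties using (index-injective)
open import Data.Product using (∃; ∃₂; _×_; _,_)
open import Relation.Binary.Construct.Closure.ReflexiveTransitive using (ε; _◅_)
open import Data.Sum using (_⊎_; inj₁; inj₂; [_,_]′)
import Data.Sum as Sum
open import Relation.Nullary using (¬_; contradiction; Dec; yes; no; does; ¬?; _×-dec_; _⊎-dec_)
open import Relation.Nullary.Decidable using (dec-true)
open import Function using (_∘_; id)
open import Function.Definitions using (Injective)
open import Relation.Binary.PropositionalEquality

private variable
  A B D : Set
  n : ℕ

lookup-injective : {xs : List A} → Unique xs → ∀ {i j} → lookup xs i ≡ lookup xs j → i ≡ j
lookup-injective {xs = x ∷ xs} (x∉xs ∷ u) {zero}  {zero}  eq = refl
lookup-injective {xs = x ∷ xs} (x∉xs ∷ u) {zero}  {suc j} eq = contradiction eq (All.lookup x∉xs (∈-lookup j))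
lookup-injective {xs = x ∷ xs} (x∉xs ∷ u) {suc i} {zero}  eq = contradiction (sym eq) (All.lookup x∉xs (∈-lookup i))
lookup-injective {xs = x ∷ xs} (x∉xs ∷ u) {suc i} {suc j} eq = cong suc (lookup-injective u eq)

Unique∧⊆⇒length≤ : {xs ys : List A} → Unique xs → (∀ {x} → x ∈ₗ xs → x ∈ₗ ys) → length xs ≤ length ys
Unique∧⊆⇒length≤ u xs⊆ys = injective⇒≤ λ eq →
  lookup-injective u (index-injective (setoid _) (xs⊆ys (∈-lookup _)) (xs⊆ys (∈-lookup _)) eq)

NumberAtMost-image : {P : A → Set} (g : B → A) (ys : List B) →
                     (∀ {x} → P x → ∃ λ y → y ∈ₗ ys × g y ≡ x) → NumberAtMost P (length ys)
NumberAtMost-image g ys cover xs u Pxs = subst (length xs ≤_) (length-map g ys) (Unique∧⊆⇒length≤ u xs⊆image)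
  where
  xs⊆image : ∀ {x} → x ∈ₗ xs → x ∈ₗ map g ys
  xs⊆image x∈xs with cover (All.lookup Pxs x∈xs)
  ... | y , y∈ys , refl = ∈-map⁺ g y∈ys

length-cartesianProductWith : (f : A → B → D) (xs : List A) (ys : List B) →
                              length (cartesianProductWith f xs ys) ≡ length xs * length ys
length-cartesianProductWith f []       ys = refl
length-cartesianProductWith f (x ∷ xs) ys = begin
  length (map (f x) ys ++ cartesianProductWith f xs ys)            ≡⟨ length-++ (map (f x) ys) ⟩
  length (map (f x) ys) + length (cartesianProductWith f xs ys)    ≡⟨ cong₂ _+_ (length-map (f x) ys)
                                                                         (length-cartesianProductWith f xs ys) ⟩
  length ys + length xs * length ys                                ∎
  where open ≡-Reasoning

words : List A → ℕ → List (List A)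
words xs zero    = [] ∷ []
words xs (suc n) = cartesianProductWith _∷_ xs (words xs n)

length-words : (xs : List A) (n : ℕ) → length (words xs n) ≡ length xs ^ n
length-words xs zero    = refl
length-words xs (suc n) =
  trans (length-cartesianProductWith _∷_ xs (words xs n)) (cong (length xs *_) (length-words xs n))

∈-words : {xs : List A} → (∀ x → x ∈ₗ xs) → (w : List A) → w ∈ₗ words xs (length w)
∈-words complete []      = here refl
∈-words complete (x ∷ w) = ∈-cartesianProductWith⁺ _∷_ (complete x) (∈-words complete w)

bools : List Bool
bools = true ∷ false ∷ []

∈-bools : ∀ b → b ∈ₗ bools
∈-bools true  = here refl
∈-bools false = there (here refl)

nCk≤[1+n]Ck : ∀ a k → a C k ≤ suc a C k
nCk≤[1+n]Ck a zero    = ≤-refl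
nCk≤[1+n]Ck a (suc k) = subst (a C suc k ≤_) (nCk+nC[k+1]≡[n+1]C[k+1] a k) (m≤n+m _ _)

C-monoˡ-≤ : ∀ {a b} k → a ≤ b → a C k ≤ b C k
C-monoˡ-≤ k a≤b = mono′ (≤⇒≤′ a≤b)
  where
  mono′ : ∀ {a b} → a ≤′ b → a C k ≤ b C k
  mono′ ≤′-refl        = ≤-refl
  mono′ (≤′-step a≤′b) = ≤-trans (mono′ a≤′b) (nCk≤[1+n]Ck _ k)

toList : Subset n → List (Fin n)
toList []            = []
toList (inside ∷ p)  = zero ∷ map suc (toList p)
toList (outside ∷ p) = map suc (toList p)

length-toList : (p : Subset n) → length (toList p) ≡ ∣ p ∣
length-toList []            = refl
length-toList (inside ∷ p)  = cong suc (trans (length-map suc (toList p)) (length-toList p))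
length-toList (outside ∷ p) = trans (length-map suc (toList p)) (length-toList p)

∈-toList : {x : Fin n} {p : Subset n} → x ∈ p → x ∈ₗ toList p
∈-toList {p = inside ∷ p}  here        = here refl
∈-toList {p = inside ∷ p}  (there x∈p) = there (∈-map⁺ suc (∈-toList x∈p))
∈-toList {p = outside ∷ p} (there x∈p) = ∈-map⁺ suc (∈-toList x∈p)

∣p∪q∣≤∣p∣+∣q∣ : (p q : Subset n) → ∣ p ∪ q ∣ ≤ ∣ p ∣ + ∣ q ∣
∣p∪q∣≤∣p∣+∣q∣ []            []            = z≤n
∣p∪q∣≤∣p∣+∣q∣ (inside ∷ p)  (s ∷ q)       = s≤s (≤-trans (∣p∪q∣≤∣p∣+∣q∣ p q) (+-monoʳ-≤ ∣ p ∣ (∣p∣≤∣x∷p∣ s q)))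
∣p∪q∣≤∣p∣+∣q∣ (outside ∷ p) (inside ∷ q)  = subst (suc ∣ p ∪ q ∣ ≤_) (sym (+-suc ∣ p ∣ ∣ q ∣)) (s≤s (∣p∪q∣≤∣p∣+∣q∣ p q))
∣p∪q∣≤∣p∣+∣q∣ (outside ∷ p) (outside ∷ q) = ∣p∪q∣≤∣p∣+∣q∣ p q

∣p∪⁅x⁆∣≡1+∣p∣ : (p : Subset n) (x : Fin n) → x ∉ p → ∣ p ∪ ⁅ x ⁆ ∣ ≡ suc ∣ p ∣
∣p∪⁅x⁆∣≡1+∣p∣ (inside ∷ p)  zero    x∉p = contradiction here x∉p
∣p∪⁅x⁆∣≡1+∣p∣ (outside ∷ p) zero    x∉p = cong (suc ∘ ∣_∣) (∪-identityʳ p)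
∣p∪⁅x⁆∣≡1+∣p∣ (inside ∷ p)  (suc x) x∉p = cong suc (∣p∪⁅x⁆∣≡1+∣p∣ p x (x∉p ∘ there))
∣p∪⁅x⁆∣≡1+∣p∣ (outside ∷ p) (suc x) x∉p = ∣p∪⁅x⁆∣≡1+∣p∣ p x (x∉p ∘ there)

x∈p∪⁅y⁆⁻ : (p : Subset n) {x y : Fin n} → x ∈ p ∪ ⁅ y ⁆ → x ∈ p ⊎ x ≡ y
x∈p∪⁅y⁆⁻ p {y = y} x∈ = Sum.map₂ (x∈⁅y⁆⇒x≡y y) (x∈p∪q⁻ p ⁅ y ⁆ x∈)

x∈⋃⁺ : {x : Fin n} {p : Subset n} {ps : List (Subset n)} → x ∈ p → p ∈ₗ ps → x ∈ ⋃ ps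
x∈⋃⁺ {ps = q ∷ ps} x∈p (here refl) = x∈p∪q⁺ (inj₁ x∈p)
x∈⋃⁺ {ps = q ∷ ps} x∈p (there p∈ps) = x∈p∪q⁺ (inj₂ (x∈⋃⁺ x∈p p∈ps))

∣⋃∣≤ : (f : A → Subset n) (k : ℕ) (xs : List A) → (∀ x → ∣ f x ∣ ≡ k) → ∣ ⋃ (map f xs) ∣ ≤ length xs * k
∣⋃∣≤ {n = n} f k []       ∣f∣≡k = ≤-reflexive (∣⊥∣≡0 n)
∣⋃∣≤         f k (x ∷ xs) ∣f∣≡k =
  ≤-trans (∣p∪q∣≤∣p∣+∣q∣ (f x) _) (+-mono-≤ (≤-reflexive (∣f∣≡k x)) (∣⋃∣≤ f k xs ∣f∣≡k))

⊆∧∣∣≤⇒≡ : {p q : Subset n} → p ⊆ q → ∣ q ∣ ≤ ∣ p ∣ → p ≡ q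
⊆∧∣∣≤⇒≡ {p = p} {q} p⊆q ∣q∣≤∣p∣ = ⊆-antisym p⊆q q⊆p
  where
  q⊆p : q ⊆ p
  q⊆p {x} x∈q with x ∈? p
  ... | yes x∈p = x∈p
  ... | no  x∉p = contradiction (p⊂q⇒∣p∣<∣q∣ (p⊆q , x , x∈q , x∉p)) (≤⇒≯ ∣q∣≤∣p∣)

x∈p⇒0<∣p∣ : {x : Fin n} {p : Subset n} → x ∈ p → 0 < ∣ p ∣
x∈p⇒0<∣p∣ {x = x} {p} x∈p =
  subst (_≤ ∣ p ∣) (∣⁅x⁆∣≡1 x) (p⊆q⇒∣p∣≤∣q∣ λ y∈⁅x⁆ → subst (_∈ p) (sym (x∈⁅y⁆⇒x≡y x y∈⁅x⁆)) x∈p)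

0<∣p∣⇒Nonempty : {p : Subset n} → 0 < ∣ p ∣ → Nonempty p
0<∣p∣⇒Nonempty {n = n} {p} 0<∣p∣ with nonempty? p
... | yes ne = ne
... | no ¬ne = contradiction (trans (cong ∣_∣ (Empty-unique ¬ne)) (∣⊥∣≡0 n)) (≢-sym (<⇒≢ 0<∣p∣))

image : ∀ {c} → (Fin c → Fin n) → Subset n
image {c = zero}  r = ⊥
image {c = suc c} r = image (r ∘ suc) ∪ ⁅ r zero ⁆

∈-image⁺ : ∀ {c} (r : Fin c → Fin n) j → r j ∈ image r
∈-image⁺ r zero    = x∈p∪q⁺ (inj₂ (x∈⁅x⁆ (r zero)))
∈-image⁺ r (suc j) = x∈p∪q⁺ (inj₁ (∈-image⁺ (r ∘ suc) j))

∈-image⁻ : ∀ {c} (r : Fin c → Fin n) {x} → x ∈ image r → ∃ λ j → x ≡ r j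
∈-image⁻ {c = zero}  r x∈r = contradiction x∈r ∉⊥
∈-image⁻ {c = suc c} r x∈r with x∈p∪⁅y⁆⁻ (image (r ∘ suc)) x∈r
... | inj₁ x∈r∘suc = let j , x≡rj = ∈-image⁻ (r ∘ suc) x∈r∘suc in suc j , x≡rj
... | inj₂ x≡r0    = zero , x≡r0

∣image∣≡ : ∀ {c} (r : Fin c → Fin n) → Injective _≡_ _≡_ r → ∣ image r ∣ ≡ c
∣image∣≡ {n = n} {c = zero}  r r-inj = ∣⊥∣≡0 n
∣image∣≡         {c = suc c} r r-inj =
  trans (∣p∪⁅x⁆∣≡1+∣p∣ (image (r ∘ suc)) (r zero) r0∉)
        (cong suc (∣image∣≡ (r ∘ suc) (Fin.suc-injective ∘ r-inj)))
  where
  r0∉ : r zero ∉ image (r ∘ suc)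
  r0∉ r0∈ with ∈-image⁻ (r ∘ suc) r0∈
  ... | j , r0≡rj with r-inj r0≡rj
  ... | ()

subsetsOfSize : Subset n → ℕ → List (Subset n)
subsetsOfSize []            zero    = [] ∷ []
subsetsOfSize []            (suc c) = []
subsetsOfSize (outside ∷ W) c       = map (outside ∷_) (subsetsOfSize W c)
subsetsOfSize (inside ∷ W)  zero    = map (outside ∷_) (subsetsOfSize W zero)
subsetsOfSize (inside ∷ W)  (suc c) =
  map (inside ∷_) (subsetsOfSize W c) ++ map (outside ∷_) (subsetsOfSize W (suc c))

length-subsetsOfSize : (W : Subset n) (c : ℕ) → length (subsetsOfSize W c) ≡ ∣ W ∣ C c
length-subsetsOfSize []            zero    = refl
length-subsetsOfSize []            (suc c) = refl
length-subsetsOfSize (outside ∷ W) c       = trans (length-map _ (subsetsOfSize W c)) (length-subsetsOfSize W c)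
length-subsetsOfSize (inside ∷ W)  zero    = trans (length-map _ (subsetsOfSize W zero)) (length-subsetsOfSize W zero)
length-subsetsOfSize (inside ∷ W)  (suc c) = begin
  length (map (inside ∷_) (subsetsOfSize W c) ++ map (outside ∷_) (subsetsOfSize W (suc c)))
    ≡⟨ length-++ (map (inside ∷_) (subsetsOfSize W c)) ⟩
  length (map (inside ∷_) (subsetsOfSize W c)) + length (map (outside ∷_) (subsetsOfSize W (suc c)))
    ≡⟨ cong₂ _+_ (length-map _ (subsetsOfSize W c)) (length-map _ (subsetsOfSize W (suc c))) ⟩
  length (subsetsOfSize W c) + length (subsetsOfSize W (suc c))
    ≡⟨ cong₂ _+_ (length-subsetsOfSize W c) (length-subsetsOfSize W (suc c)) ⟩
  ∣ W ∣ C c + ∣ W ∣ C suc c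
    ≡⟨ nCk+nC[k+1]≡[n+1]C[k+1] ∣ W ∣ c ⟩
  suc ∣ W ∣ C suc c ∎
  where open ≡-Reasoning

∈-subsetsOfSize : {R W : Subset n} → R ⊆ W → ∀ {c} → ∣ R ∣ ≡ c → R ∈ₗ subsetsOfSize W c
∈-subsetsOfSize {R = []}           {[]}          R⊆W {zero}  refl = here refl
∈-subsetsOfSize {R = inside ∷ R}   {outside ∷ W} R⊆W         refl = contradiction (R⊆W here) λ ()
∈-subsetsOfSize {R = inside ∷ R}   {inside ∷ W}  R⊆W {suc c} ∣R∣≡c =
  ∈-++⁺ˡ (∈-map⁺ (inside ∷_) (∈-subsetsOfSize (drop-∷-⊆ R⊆W) (suc-injective ∣R∣≡c)))
∈-subsetsOfSize {R = outside ∷ R}  {outside ∷ W} R⊆W         ∣R∣≡c =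
  ∈-map⁺ (outside ∷_) (∈-subsetsOfSize (drop-∷-⊆ R⊆W) ∣R∣≡c)
∈-subsetsOfSize {R = outside ∷ R}  {inside ∷ W}  R⊆W {zero}  ∣R∣≡c =
  ∈-map⁺ (outside ∷_) (∈-subsetsOfSize (drop-∷-⊆ R⊆W) ∣R∣≡c)
∈-subsetsOfSize {R = outside ∷ R}  {inside ∷ W}  R⊆W {suc c} ∣R∣≡c =
  ∈-++⁺ʳ (map (inside ∷_) (subsetsOfSize W c)) (∈-map⁺ (outside ∷_) (∈-subsetsOfSize (drop-∷-⊆ R⊆W) ∣R∣≡c))

head∘drop-index : {x : A} {xs : List A} (x∈xs : x ∈ₗ xs) → head (drop (toℕ (Any.index x∈xs)) xs) ≡ just x
head∘drop-index (here refl)  = refl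
head∘drop-index (there x∈xs) = head∘drop-index x∈xs

module _ (G : Hypergraph n) where

  vertices : Subset (m G) → Subset n
  vertices F = ⋃ (map (edge G) (toList F))

  ∈-vertices : ∀ {F v} → InV G F v → v ∈ vertices F
  ∈-vertices (e , e∈F , v∈e) = x∈⋃⁺ v∈e (∈-map⁺ (edge G) (∈-toList e∈F))

  ∣vertices∣≤ : ∀ {k} → Uniform k G → (F : Subset (m G)) → ∣ vertices F ∣ ≤ ∣ F ∣ * k
  ∣vertices∣≤ {k} uniform F =
    subst (λ l → ∣ vertices F ∣ ≤ l * k) (length-toList F) (∣⋃∣≤ (edge G) k (toList F) uniform)

  Reaches : Subset n → Subset (m G) → Set
  Reaches R F = ∀ {e} → e ∈ F → ∃ λ v → v ∈ edge G e × ∃ λ w → w ∈ R × Conn G F v w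

  components⇒roots : ∀ {k F c} → Uniform k G → HasComponents G F (suc c) →
                     ∃ λ R → ∣ R ∣ ≡ suc c × (∀ {v} → v ∈ R → InV G F v) × Reaches R F
  components⇒roots {k} {F} uniform (r , r∈V , r-separated , r-covers) =
    image r , ∣image∣≡ r r-injective , R⊆V , reaches
    where
    r-injective : Injective _≡_ _≡_ r
    r-injective {i} {j} ri≡rj = r-separated i j (subst (Conn G F (r i)) ri≡rj ε)

    R⊆V : ∀ {v} → v ∈ image r → InV G F v
    R⊆V v∈R with ∈-image⁻ r v∈R
    ... | j , refl = r∈V j

    edges-nonempty : ∀ e → Nonempty (edge G e)
    edges-nonempty e with r∈V zero
    ... | e₀ , _ , r₀∈e₀ = 0<∣p∣⇒Nonempty (subst (0 <_) (trans (uniform e₀) (sym (uniform e))) (x∈p⇒0<∣p∣ r₀∈e₀))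

    reaches : Reaches (image r) F
    reaches {e} e∈F with edges-nonempty e
    ... | v , v∈e with r-covers v (e , e∈F , v∈e)
    ... | j , walk = v , v∈e , r j , ∈-image⁺ r j , walk

  incidentEdges : Fin n → Subset (m G)
  incidentEdges v = tabulate λ e → does (v ∈? edge G e)

  ∈-incidentEdges : ∀ {v e} → v ∈ edge G e → e ∈ incidentEdges v
  ∈-incidentEdges {v} {e} v∈e = lookup⇒[]= e _ (trans (lookup∘tabulate _ e) (dec-true (v ∈? edge G e) v∈e))

  module _ {Δ : ℕ} (Δ≥deg : MaxDegreeAtMost G Δ) where

    label : ∀ {v e} → v ∈ edge G e → Fin Δ
    label {v} v∈e = inject≤ (Any.index (∈-toList (∈-incidentEdges v∈e)))
                            (subst (_≤ Δ) (sym (length-toList (incidentEdges v))) (Δ≥deg v))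

    edgeAt : Fin n → Fin Δ → Maybe (Fin (m G))
    edgeAt v j = head (drop (toℕ j) (toList (incidentEdges v)))

    edgeAt-label : ∀ {v e} (v∈e : v ∈ edge G e) → edgeAt v (label v∈e) ≡ just e
    edgeAt-label {v} {e} v∈e = begin
      head (drop (toℕ (label v∈e)) (toList (incidentEdges v)))      ≡⟨ cong (λ i → head (drop i _)) (toℕ-inject≤ (Any.index e∈) _) ⟩
      head (drop (toℕ (Any.index e∈)) (toList (incidentEdges v)))   ≡⟨ head∘drop-index e∈ ⟩
      just e                                                        ∎
      where
      open ≡-Reasoning
      e∈ : e ∈ₗ toList (incidentEdges v)
      e∈ = ∈-toList (∈-incidentEdges v∈e)

    module Exploration (R : Subset n) where

      record State : Set where
        constructor ⟨_,_⟩
        field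
          explored : Subset n
          chosen   : Subset (m G)
      open State public

      Discovered : State → Fin n → Set
      Discovered s v = v ∈ R ⊎ ∃ λ e → e ∈ chosen s × v ∈ edge G e

      Pending : State → Fin n → Set
      Pending s v = Discovered s v × v ∉ explored s

      pending? : (s : State) → Dec (∃ (Pending s))
      pending? s = any? λ v →
        ((v ∈? R) ⊎-dec any? (λ e → (e ∈? chosen s) ×-dec (v ∈? edge G e))) ×-dec ¬? (v ∈? explored s)

      explore : (s : State) → Dec (∃ (Pending s)) → State
      explore s (yes (v , _)) = ⟨ explored s ∪ ⁅ v ⁆ , chosen s ⟩
      explore s (no _)        = s

      choose : State → Fin (m G) → State
      choose s e = ⟨ explored s , chosen s ∪ ⁅ e ⁆ ⟩

      extend : (s : State) → Dec (∃ (Pending s)) → Fin Δ → State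
      extend s (yes (v , _)) j = maybe′ (choose s) s (edgeAt v j)
      extend s (no _)        j = s

      -- The decision of pending? is an argument of runAt so that proofs can match on it.
      run   : State → List Bool → List (Fin Δ) → State
      runAt : (s : State) → Dec (∃ (Pending s)) → List Bool → List (Fin Δ) → State
      run s = runAt s (pending? s)
      runAt s d []           ls       = s
      runAt s d (false ∷ bs) ls       = run (explore s d) bs ls
      runAt s d (true ∷ bs)  []       = s
      runAt s d (true ∷ bs)  (j ∷ ls) = run (extend s d j) bs ls

      initial : State
      initial = ⟨ ⊥ , ⊥ ⟩

      progress : State → ℕ
      progress s = ∣ explored s ∣ + ∣ chosen s ∣

      module Reconstruction {k : ℕ} (uniform : Uniform k G) (F : Subset (m G)) (R⊆VF : R ⊆ vertices F)
               (reach : Reaches R F) where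

        record Invariant (s : State) : Set where
          field
            explored⇒discovered : ∀ {v} → v ∈ explored s → Discovered s v
            chosen⊆F            : chosen s ⊆ F
            explored-saturated  : ∀ {v e} → v ∈ explored s → e ∈ F → v ∈ edge G e → e ∈ chosen s
        open Invariant

        Unchosen : State → Fin n → Set
        Unchosen s v = ∃ λ e → e ∈ F × e ∉ chosen s × v ∈ edge G e

        unchosen? : ∀ s v → Dec (Unchosen s v)
        unchosen? s v = any? λ e → (e ∈? F) ×-dec ¬? (e ∈? chosen s) ×-dec (v ∈? edge G e)

        initial-invariant : Invariant initial
        initial-invariant = record
          { explored⇒discovered = λ v∈⊥ → contradiction v∈⊥ ∉⊥
          ; chosen⊆F            = λ e∈⊥ → contradiction e∈⊥ ∉⊥
          ; explored-saturated  = λ v∈⊥ _ _ → contradiction v∈⊥ ∉⊥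
          }

        choose-invariant : ∀ {s e} → Invariant s → e ∈ F → Invariant (choose s e)
        choose-invariant {s} {e} I e∈F = record
          { explored⇒discovered = λ v∈X → Sum.map₂ (λ (e′ , e′∈A , v∈e′) → e′ , p⊆p∪q ⁅ e ⁆ e′∈A , v∈e′)
                                                   (explored⇒discovered I v∈X)
          ; chosen⊆F            = λ e′∈ → [ chosen⊆F I , (λ { refl → e∈F }) ]′ (x∈p∪⁅y⁆⁻ (chosen s) e′∈)
          ; explored-saturated  = λ v∈X e′∈F v∈e′ → p⊆p∪q ⁅ e ⁆ (explored-saturated I v∈X e′∈F v∈e′)
          }

        explore-invariant : ∀ {s v} → Invariant s → Discovered s v → ¬ Unchosen s v →
                            Invariant ⟨ explored s ∪ ⁅ v ⁆ , chosen s ⟩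
        explore-invariant {s} {v} I v-disc none = record
          { explored⇒discovered = λ u∈ → [ explored⇒discovered I , (λ { refl → v-disc }) ]′
                                             (x∈p∪⁅y⁆⁻ (explored s) u∈)
          ; chosen⊆F            = chosen⊆F I
          ; explored-saturated  = λ u∈ e∈F u∈e →
              [ (λ u∈X → explored-saturated I u∈X e∈F u∈e) , (λ { refl → v-saturated e∈F u∈e }) ]′
              (x∈p∪⁅y⁆⁻ (explored s) u∈)
          }
          where
          v-saturated : ∀ {e} → e ∈ F → v ∈ edge G e → e ∈ chosen s
          v-saturated {e} e∈F v∈e with e ∈? chosen s
          ... | yes e∈A = e∈A
          ... | no  e∉A = contradiction (e , e∈F , e∉A , v∈e) none

        stuck⇒complete : ∀ {s} → Invariant s → ¬ ∃ (Pending s) → chosen s ≡ F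
        stuck⇒complete {s} I stuck = ⊆-antisym (chosen⊆F I) F⊆A
          where
          discovered⇒explored : ∀ {v} → Discovered s v → v ∈ explored s
          discovered⇒explored {v} v-disc with v ∈? explored s
          ... | yes v∈X = v∈X
          ... | no  v∉X = contradiction (v , v-disc , v∉X) stuck

          discovered-closed : ∀ {u w} → Conn G F u w → Discovered s w → Discovered s u
          discovered-closed ε                             w-disc = w-disc
          discovered-closed ((e , e∈F , u∈e , x∈e) ◅ walk) w-disc =
            inj₂ (e , explored-saturated I (discovered⇒explored (discovered-closed walk w-disc)) e∈F x∈e , u∈e)

          F⊆A : F ⊆ chosen s
          F⊆A e∈F with reach e∈F
          ... | v , v∈e , w , w∈R , walk =
            explored-saturated I (discovered⇒explored (discovered-closed walk (inj₁ w∈R))) e∈F v∈e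

        discovered⇒∈vertices : ∀ {s v} → Invariant s → Discovered s v → v ∈ vertices F
        discovered⇒∈vertices I (inj₁ v∈R)             = R⊆VF v∈R
        discovered⇒∈vertices I (inj₂ (e , e∈A , v∈e)) = ∈-vertices (e , chosen⊆F I e∈A , v∈e)

        exhausted⇒complete : ∀ {s} → Invariant s → (k + 1) * ∣ F ∣ ≤ progress s → chosen s ≡ F
        exhausted⇒complete {s} I exhausted =
          ⊆∧∣∣≤⇒≡ (chosen⊆F I) (+-cancelˡ-≤ (∣ F ∣ * k) ∣ F ∣ ∣ chosen s ∣ (begin
            ∣ F ∣ * k + ∣ F ∣                ≡⟨ cong₂ _+_ (*-comm ∣ F ∣ k) (sym (*-identityˡ ∣ F ∣)) ⟩
            k * ∣ F ∣ + 1 * ∣ F ∣            ≡⟨ *-distribʳ-+ ∣ F ∣ k 1 ⟨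
            (k + 1) * ∣ F ∣                  ≤⟨ exhausted ⟩
            ∣ explored s ∣ + ∣ chosen s ∣    ≤⟨ +-monoˡ-≤ ∣ chosen s ∣ ∣X∣≤ ⟩
            ∣ F ∣ * k + ∣ chosen s ∣         ∎))
          where
          open ≤-Reasoning
          ∣X∣≤ : ∣ explored s ∣ ≤ ∣ F ∣ * k
          ∣X∣≤ = ≤-trans (p⊆q⇒∣p∣≤∣q∣ (discovered⇒∈vertices I ∘ explored⇒discovered I)) (∣vertices∣≤ uniform F)

        record Encoding (s : State) (d : Dec (∃ (Pending s))) (f : ℕ) : Set where
          field
            bits          : List Bool
            labels        : List (Fin Δ)
            length-bits   : length bits ≡ f
            length-labels : length labels + ∣ chosen s ∣ ≡ ∣ F ∣
            decodes       : chosen (runAt s d bits labels) ≡ F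
        open Encoding public

        -- Surplus bits are 1s: with no label left, a 1 halts the decoder.
        complete⇒encoding : ∀ {s d} f → chosen s ≡ F → Encoding s d f
        complete⇒encoding {s} {d} f A≡F = record
          { bits          = replicate f true
          ; labels        = []
          ; length-bits   = length-replicate f
          ; length-labels = cong ∣_∣ A≡F
          ; decodes       = decodes-idle f
          }
          where
          decodes-idle : ∀ f → chosen (runAt s d (replicate f true) []) ≡ F
          decodes-idle zero    = A≡F
          decodes-idle (suc f) = A≡F

        spend-fuel : ∀ {a f p p′} → a ≤ suc f + p → p′ ≡ suc p → a ≤ f + p′
        spend-fuel {a} {f} {p} fuel refl = subst (a ≤_) (sym (+-suc f p)) fuel

        encode : ∀ f s d → Invariant s → (k + 1) * ∣ F ∣ ≤ f + progress s → Encoding s d f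
        encode zero    s d                           I fuel = complete⇒encoding zero (exhausted⇒complete I fuel)
        encode (suc f) s (no stuck)                  I fuel = complete⇒encoding (suc f) (stuck⇒complete I stuck)
        encode (suc f) s (yes (v , v-disc , v∉X))    I fuel with unchosen? s v
        ... | yes (e , e∈F , e∉A , v∈e) = record
          { bits          = true ∷ bits E
          ; labels        = label v∈e ∷ labels E
          ; length-bits   = cong suc (length-bits E)
          ; length-labels = trans (sym (+-suc _ _)) (trans (cong (length (labels E) +_) (sym grows)) (length-labels E))
          ; decodes       = trans (cong (λ e? → chosen (run (maybe′ (choose s) s e?) (bits E) (labels E))) (edgeAt-label v∈e))
                                  (decodes E)
          }
          where
          grows : ∣ chosen s ∪ ⁅ e ⁆ ∣ ≡ suc ∣ chosen s ∣
          grows = ∣p∪⁅x⁆∣≡1+∣p∣ (chosen s) e e∉A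
          E : Encoding (choose s e) (pending? (choose s e)) f
          E = encode f (choose s e) _ (choose-invariant I e∈F)
                (spend-fuel {f = f} fuel (trans (cong (∣ explored s ∣ +_) grows) (+-suc _ _)))
        ... | no none = record
          { bits          = false ∷ bits E
          ; labels        = labels E
          ; length-bits   = cong suc (length-bits E)
          ; length-labels = length-labels E
          ; decodes       = decodes E
          }
          where
          s′ : State
          s′ = ⟨ explored s ∪ ⁅ v ⁆ , chosen s ⟩
          E : Encoding s′ (pending? s′) f
          E = encode f s′ _ (explore-invariant I v-disc none)
                (spend-fuel {f = f} fuel (cong (_+ ∣ chosen s ∣) (∣p∪⁅x⁆∣≡1+∣p∣ (explored s) v v∉X)))

    Code : Set
    Code = Subset n × List Bool × List (Fin Δ)

    decode : Code → Subset (m G)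
    decode (R , bs , ls) = chosen (run initial bs ls)
      where open Exploration R

    decode-surjective : ∀ {k} → Uniform k G → ∀ F R → R ⊆ vertices F → Reaches R F →
                        ∃₂ λ bs ls → length bs ≡ (k + 1) * ∣ F ∣ × length ls ≡ ∣ F ∣ × decode (R , bs , ls) ≡ F
    decode-surjective {k} uniform F R R⊆VF reach =
      bits E , labels E , length-bits E ,
      trans (sym (trans (cong (length (labels E) +_) (∣⊥∣≡0 (m G))) (+-identityʳ _))) (length-labels E) ,
      decodes E
      where
      open Exploration R
      open Reconstruction uniform F R⊆VF reach
      E : Encoding initial (pending? initial) ((k + 1) * ∣ F ∣)
      E = encode _ initial _ initial-invariant (m≤m+n _ _)

    codes : Subset n → (L t c : ℕ) → List Code
    codes W L t c = cartesianProduct (subsetsOfSize W c) (cartesianProduct (words bools L) (words (allFin Δ) t))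

    length-codes : ∀ W L t c → length (codes W L t c) ≡ (∣ W ∣ C c) * (2 ^ L * Δ ^ t)
    length-codes W L t c = begin
      length (codes W L t c)
        ≡⟨ length-cartesianProductWith _,_ (subsetsOfSize W c) _ ⟩
      length (subsetsOfSize W c) * length (cartesianProduct (words bools L) (words (allFin Δ) t))
        ≡⟨ cong (length (subsetsOfSize W c) *_) (length-cartesianProductWith _,_ (words bools L) _) ⟩
      length (subsetsOfSize W c) * (length (words bools L) * length (words (allFin Δ) t))
        ≡⟨ cong₂ _*_ (length-subsetsOfSize W c) (cong₂ _*_ (length-words bools L) (length-words (allFin Δ) t)) ⟩
      (∣ W ∣ C c) * (2 ^ L * length (allFin Δ) ^ t)
        ≡⟨ cong (λ d → (∣ W ∣ C c) * (2 ^ L * d ^ t)) (length-tabulate id) ⟩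
      (∣ W ∣ C c) * (2 ^ L * Δ ^ t) ∎
      where open ≡-Reasoning

    counted⇒decoded : ∀ {k S t c F} → Uniform k G → Counted G S t (suc c) F →
                      ∃ λ code → code ∈ₗ codes (vertices S) ((k + 1) * t) t (suc c) × decode code ≡ F
    counted⇒decoded {k} {S} {F = F} uniform (F⊆S , refl , components) with components⇒roots uniform components
    ... | R , ∣R∣≡c , R⊆V , reach with decode-surjective uniform F R (∈-vertices ∘ R⊆V) reach
    ... | bs , ls , length-bs , length-ls , decodes =
      (R , bs , ls) ,
      ∈-cartesianProduct⁺ (∈-subsetsOfSize R⊆VS ∣R∣≡c)
        (∈-cartesianProduct⁺ (subst (λ L → bs ∈ₗ words bools L) length-bs (∈-words ∈-bools bs))
                             (subst (λ t → ls ∈ₗ words (allFin Δ) t) length-ls (∈-words ∈-allFin ls))) ,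
      decodes
      where
      R⊆VS : R ⊆ vertices S
      R⊆VS v∈R = let e , e∈F , v∈e = R⊆V v∈R in ∈-vertices (e , F⊆S e∈F , v∈e)

lemma3p2 : (n k Δ : ℕ) (G : Hypergraph n) → Uniform k G → MaxDegreeAtMost G Δ →
           (S : Subset (m G)) → Nonempty S →
           (t c : ℕ) → NonZero t → NonZero c →
           NumberAtMost (Counted G S t c) (2 ^ ((k + 1) * t) * Δ ^ t * ((k * ∣ S ∣) C c))
lemma3p2 n k Δ G uniform Δ≥deg S _ t zero    _ ()
lemma3p2 n k Δ G uniform Δ≥deg S _ t (suc c) _ _ xs unique counted = begin
  length xs
    ≤⟨ NumberAtMost-image (decode G Δ≥deg) (codes G Δ≥deg (vertices G S) L t (suc c))
                          (counted⇒decoded G Δ≥deg uniform) xs unique counted ⟩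
  length (codes G Δ≥deg (vertices G S) L t (suc c))
    ≡⟨ length-codes G Δ≥deg (vertices G S) L t (suc c) ⟩
  (∣ vertices G S ∣ C suc c) * (2 ^ L * Δ ^ t)
    ≤⟨ *-monoˡ-≤ (2 ^ L * Δ ^ t) (C-monoˡ-≤ (suc c) (≤-trans (∣vertices∣≤ G uniform S) (≤-reflexive (*-comm ∣ S ∣ k)))) ⟩
  ((k * ∣ S ∣) C suc c) * (2 ^ L * Δ ^ t)
    ≡⟨ *-comm ((k * ∣ S ∣) C suc c) (2 ^ L * Δ ^ t) ⟩
  2 ^ L * Δ ^ t * ((k * ∣ S ∣) C suc c) ∎
  where
  open ≤-Reasoning
  L : ℕ
  L = (k + 1) * t
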